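{- Let $k$ be a positive integer and let $X,X'\subseteq[k]$ be such that $(X',X'_{(k)})$ is a shuffling of $(X,X_{(k)})$, i.e. $X\cup X_{(k)}=X'\cup X'_{(k)}$ and $X\cap X_{(k)}=X'\cap X'_{(k)}$. Let $Z\subseteq[k]$ be disjoint from $X\cup X_{(k)}$ and satisfy $Z=Z_{(k)}$. Then $$\frac{\Delta_1(X'\cup Z)}{\Delta_1(X\cup Z)}=\frac{\Delta_1(X')}{\Delta_1(X)}.$$
   Context: $[k]=\{1,\dots,k\}$. For $S\subseteq[k]$, $S_{(k)}=\{k+1-s: s\in S\}$. For a finite set $S$ of integers, $\Delta_1(S)=\prod_{s,s'\in S,\ s<s'}(s'-s)$ (empty product $=1$). -}

module Defs where

open import Data.Nat using (ℕ; _∸_; _<ᵇ_)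
open import Data.Bool using (Bool; if_then_else_; _∧_)
open import Data.Fin using (Fin; toℕ; opposite)
open import Data.Fin.Subset using (Subset)
open import Data.Vec using (lookup; tabulate)
open import Data.List using (map; allFin)
open import Data.Nat.ListAction using (product)

-- A subset S ⊆ [k] is encoded as a Subset k (Vec Bool k); the element
-- i : Fin k stands for the integer toℕ i + 1 ∈ [k].

-- S_(k) = { k+1-s : s ∈ S }.  Element i (integer i+1) lies in S_(k)
-- iff k+1-(i+1) = k - i, i.e. opposite i (integer (k-1-i)+1), lies in S.
reflect : ∀ {k} → Subset k → Subset k
reflect S = tabulate (λ i → lookup S (opposite i))

Δ-factor : ∀ {k} → Subset k → Fin k → Fin k → ℕ
Δ-factor S i j =
  if lookup S i ∧ lookup S j ∧ (toℕ i <ᵇ toℕ j) then toℕ j ∸ toℕ i else 1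

-- Δ₁(S) = ∏_{s<s' in S} (s' - s)  (shifting all elements by 1 does not change differences)
Δ₁ : ∀ {k} → Subset k → ℕ
Δ₁ {k} S = product (map (λ i → product (map (Δ-factor S i) (allFin k))) (allFin k))

-- For disjoint A and B, Δ₁(A ∪ B) = Δ₁(A) Δ₁(B) c(A, B) with the cross term
-- c(A, B) = ∏_{a ∈ A, b ∈ B} |a - b| = ∏_{a ∈ A} w_B(a),  w_B(a) = ∏_{b ∈ B} |a - b|.
-- If Z = Z_(k), then w_Z is invariant under a ↦ k + 1 - a, so
-- (∏_X w_Z)² = ∏_X w_Z · ∏_{X_(k)} w_Z = ∏_{X ∪ X_(k)} w_Z · ∏_{X ∩ X_(k)} w_Z
-- depends only on X ∪ X_(k) and X ∩ X_(k).  Hence c(X, Z) = c(X', Z), and the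
-- factors Δ₁(Z) c(X, Z) cancel from both sides.
module Submission where

open import Defs
open import Data.Nat using (ℕ; zero; suc; _+_; _*_; _∸_; _≤_; _<ᵇ_)
open import Data.Nat.Properties
  using (*-1-commutativeMonoid; *-comm; *-identityˡ; *-identityʳ; *-mono-<; <-cmp; <-irrefl;
         +-comm; m∸n+n≡m; ≤-pred)
open import Data.Nat.Solver using (module +-*-Solver)
open import Data.Bool using (Bool; true; false; if_then_else_; _∧_; _∨_)
open import Data.Fin using (Fin; toℕ; opposite)
import Data.Fin as Fin
open import Data.Fin.Properties using (opposite-prop; opposite-involutive; toℕ<n)
open import Data.Fin.Permutation using (reverse)
open import Data.Fin.Subset using (Subset; _∪_; _∩_; ⊥; _⊆_; _∈_)
open import Data.Fin.Subset.Properties using (Empty-unique; ∉⊥; x∈p∩q⁺; x∈p∩q⁻; p⊆p∪q; ∩-comm)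
open import Data.Vec using (lookup)
open import Data.Vec.Properties using (lookup∘tabulate; lookup-zipWith; lookup-replicate)
open import Data.List using (map; allFin)
import Data.List as List
open import Data.List.Properties using (map-tabulate)
open import Data.Nat.ListAction using (product)
open import Data.Product using (_,_)
open import Function using (_∘_)
open import Relation.Binary.Definitions using (tri<; tri≈; tri>)
open import Relation.Binary.PropositionalEquality
open import Relation.Nullary using (contradiction)
open import Algebra.Properties.CommutativeMonoid.Sum *-1-commutativeMonoid
  using () renaming (sum to ∏; sum-cong-≗ to ∏-cong; sum-replicate-zero to ∏-1;
                     ∑-distrib-+ to ∏-distrib-*; ∑-comm to ∏-comm; ∑-permute to ∏-permute)

open ≡-Reasoning
open +-*-Solver using (solve; _:*_; _:=_)

private
  variable
    k : ℕ

*-self-injective : ∀ m n → m * m ≡ n * n → m ≡ n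
*-self-injective m n e with <-cmp m n
... | tri≈ _ m≡n _ = m≡n
... | tri< m<n _ _ = contradiction (*-mono-< m<n m<n) (<-irrefl e)
... | tri> _ _ n<m = contradiction (*-mono-< n<m n<m) (<-irrefl (sym e))

product-map-allFin : ∀ n (f : Fin n → ℕ) → product (map f (allFin n)) ≡ ∏ f
product-map-allFin n f = trans (cong product (map-tabulate (λ i → i) f)) (product-tabulate n f)
  where
  product-tabulate : ∀ n (f : Fin n → ℕ) → product (List.tabulate f) ≡ ∏ f
  product-tabulate zero    f = refl
  product-tabulate (suc n) f = cong (f Fin.zero *_) (product-tabulate n (f ∘ Fin.suc))

∏-reverse : (f : Fin k → ℕ) → ∏ (f ∘ opposite) ≡ ∏ f
∏-reverse f = sym (∏-permute f reverse)

when : Bool → ℕ → ℕ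
when b v = if b then v else 1

∏-when : ∀ b (g : Fin k → ℕ) → ∏ (λ j → when b (g j)) ≡ when b (∏ g)
∏-when true  g = refl
∏-when {k} false g = ∏-1 k

gap : ℕ → ℕ → ℕ
gap a b = when (a <ᵇ b) (b ∸ a)

gap-+ : ∀ t {x y} → gap (t + x) (t + y) ≡ gap x y
gap-+ zero    = refl
gap-+ (suc t) = gap-+ t

gap-reflect : ∀ x y a b → x + a ≡ y + b → gap x y ≡ gap b a
gap-reflect x y a b e = begin
  gap x y             ≡⟨ gap-+ b ⟨
  gap (b + x) (b + y) ≡⟨ cong₂ gap (+-comm b x) (trans (+-comm b y) (sym e)) ⟩
  gap (x + b) (x + a) ≡⟨ gap-+ x ⟩
  gap b a             ∎

-- dist a b = |a - b| for a ≢ b, and 1 for a ≡ b.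
dist : ℕ → ℕ → ℕ
dist a b = gap a b * gap b a

dist-reflect : ∀ x y a b → x + a ≡ y + b → dist x y ≡ dist a b
dist-reflect x y a b e = begin
  gap x y * gap y x ≡⟨ cong₂ _*_ (gap-reflect x y a b e) (gap-reflect y x b a (sym e)) ⟩
  gap b a * gap a b ≡⟨ *-comm (gap b a) (gap a b) ⟩
  gap a b * gap b a ∎

dist-opposite : (i j : Fin k) → dist (toℕ (opposite i)) (toℕ (opposite j)) ≡ dist (toℕ i) (toℕ j)
dist-opposite i j =
  dist-reflect _ _ (toℕ i) (toℕ j) (trans (toℕ-opposite+toℕ i) (sym (toℕ-opposite+toℕ j)))
  where
  toℕ-opposite+toℕ : ∀ {n} (i : Fin n) → toℕ (opposite i) + toℕ i ≡ n ∸ 1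
  toℕ-opposite+toℕ {suc n} i rewrite opposite-prop i = m∸n+n≡m (≤-pred (toℕ<n i))

lookup-∪ : ∀ (A B : Subset k) i → lookup (A ∪ B) i ≡ (lookup A i ∨ lookup B i)
lookup-∪ A B i = lookup-zipWith _∨_ i A B

lookup-∩ : ∀ (A B : Subset k) i → lookup (A ∩ B) i ≡ (lookup A i ∧ lookup B i)
lookup-∩ A B i = lookup-zipWith _∧_ i A B

lookup-reflect : ∀ (A : Subset k) i → lookup (reflect A) i ≡ lookup A (opposite i)
lookup-reflect A = lookup∘tabulate (lookup A ∘ opposite)

∩≡⊥⇒lookup-∧≡false : ∀ {A B : Subset k} → A ∩ B ≡ ⊥ → ∀ i → (lookup A i ∧ lookup B i) ≡ false
∩≡⊥⇒lookup-∧≡false {A = A} {B} A∩B≡⊥ i =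
  trans (sym (lookup-∩ A B i)) (trans (cong (λ S → lookup S i) A∩B≡⊥) (lookup-replicate i false))

∩≡⊥-antimonoˡ : ∀ {A B : Subset k} C → A ⊆ B → B ∩ C ≡ ⊥ → A ∩ C ≡ ⊥
∩≡⊥-antimonoˡ {A = A} {B} C A⊆B B∩C≡⊥ = Empty-unique λ (x , x∈A∩C) →
  let x∈A , x∈C = x∈p∩q⁻ A C x∈A∩C
  in ∉⊥ (subst (x ∈_) B∩C≡⊥ (x∈p∩q⁺ (A⊆B x∈A , x∈C)))

Δ₂-factor : Subset k → Subset k → Fin k → Fin k → ℕ
Δ₂-factor A B i j = when (lookup A i ∧ lookup B j) (gap (toℕ i) (toℕ j))

Δ₂ : Subset k → Subset k → ℕ
Δ₂ A B = ∏ λ i → ∏ (Δ₂-factor A B i)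

Δ₁≡Δ₂ : (S : Subset k) → Δ₁ S ≡ Δ₂ S S
Δ₁≡Δ₂ {k} S = trans (product-map-allFin k _) (∏-cong λ i →
  trans (product-map-allFin k _) (∏-cong λ j → if-∧-∧ (lookup S i) (lookup S j)))
  where
  if-∧-∧ : ∀ a b {c d} → (if a ∧ b ∧ c then d else 1) ≡ when (a ∧ b) (when c d)
  if-∧-∧ true  true  = refl
  if-∧-∧ true  false = refl
  if-∧-∧ false _     = refl

∏²-distrib-* : (f g : Fin k → Fin k → ℕ) →
  ∏ (λ i → ∏ λ j → f i j * g i j) ≡ ∏ (λ i → ∏ (f i)) * ∏ (λ i → ∏ (g i))
∏²-distrib-* f g = trans (∏-cong λ i → ∏-distrib-* (f i) (g i)) (∏-distrib-* (λ i → ∏ (f i)) (λ i → ∏ (g i)))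

Δ₂-∪ˡ : ∀ (A B C : Subset k) → A ∩ B ≡ ⊥ → Δ₂ (A ∪ B) C ≡ Δ₂ A C * Δ₂ B C
Δ₂-∪ˡ A B C A∩B≡⊥ = trans (∏-cong λ i → ∏-cong λ j →
    trans (cong (λ a → when (a ∧ lookup C j) _) (lookup-∪ A B i))
          (when-∨-∧ (lookup A i) (lookup B i) (lookup C j) (∩≡⊥⇒lookup-∧≡false A∩B≡⊥ i)))
  (∏²-distrib-* (Δ₂-factor A C) (Δ₂-factor B C))
  where
  when-∨-∧ : ∀ a b c {d} → (a ∧ b) ≡ false → when ((a ∨ b) ∧ c) d ≡ when (a ∧ c) d * when (b ∧ c) d
  when-∨-∧ true  false c _ = sym (*-identityʳ _)
  when-∨-∧ false b     c _ = sym (*-identityˡ _)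

Δ₂-∪ʳ : ∀ (A B C : Subset k) → B ∩ C ≡ ⊥ → Δ₂ A (B ∪ C) ≡ Δ₂ A B * Δ₂ A C
Δ₂-∪ʳ A B C B∩C≡⊥ = trans (∏-cong λ i → ∏-cong λ j →
    trans (cong (λ b → when (lookup A i ∧ b) _) (lookup-∪ B C j))
          (when-∧-∨ (lookup A i) (lookup B j) (lookup C j) (∩≡⊥⇒lookup-∧≡false B∩C≡⊥ j)))
  (∏²-distrib-* (Δ₂-factor A B) (Δ₂-factor A C))
  where
  when-∧-∨ : ∀ a b c {d} → (b ∧ c) ≡ false → when (a ∧ (b ∨ c)) d ≡ when (a ∧ b) d * when (a ∧ c) d
  when-∧-∨ false b     c _ = refl
  when-∧-∨ true  true  false _ = sym (*-identityʳ _)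
  when-∧-∨ true  false c _ = sym (*-identityˡ _)

cross : Subset k → Subset k → ℕ
cross A B = Δ₂ A B * Δ₂ B A

Δ₁-∪ : ∀ (A B : Subset k) → A ∩ B ≡ ⊥ → Δ₁ (A ∪ B) ≡ (Δ₁ A * Δ₁ B) * cross A B
Δ₁-∪ A B A∩B≡⊥ = begin
  Δ₁ (A ∪ B)                                ≡⟨ Δ₁≡Δ₂ (A ∪ B) ⟩
  Δ₂ (A ∪ B) (A ∪ B)                        ≡⟨ Δ₂-∪ˡ A B (A ∪ B) A∩B≡⊥ ⟩
  Δ₂ A (A ∪ B) * Δ₂ B (A ∪ B)               ≡⟨ cong₂ _*_ (Δ₂-∪ʳ A A B A∩B≡⊥) (Δ₂-∪ʳ B A B A∩B≡⊥) ⟩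
  (Δ₂ A A * Δ₂ A B) * (Δ₂ B A * Δ₂ B B)     ≡⟨ solve 4 (λ a b c d → (a :* b) :* (c :* d) := (a :* d) :* (b :* c))
                                                 refl (Δ₂ A A) (Δ₂ A B) (Δ₂ B A) (Δ₂ B B) ⟩
  (Δ₂ A A * Δ₂ B B) * cross A B             ≡⟨ cong (λ n → n * cross A B) (cong₂ _*_ (Δ₁≡Δ₂ A) (Δ₁≡Δ₂ B)) ⟨
  (Δ₁ A * Δ₁ B) * cross A B                 ∎

∏∈ : Subset k → (Fin k → ℕ) → ℕ
∏∈ S v = ∏ λ i → when (lookup S i) (v i)

∏∈-cong : ∀ (S : Subset k) {v w : Fin k → ℕ} → v ≗ w → ∏∈ S v ≡ ∏∈ S w
∏∈-cong S v≗w = ∏-cong λ i → cong (when (lookup S i)) (v≗w i)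

∏∈-∪-∩ : ∀ (S T : Subset k) v → ∏∈ S v * ∏∈ T v ≡ ∏∈ (S ∪ T) v * ∏∈ (S ∩ T) v
∏∈-∪-∩ {k} S T v = begin
  ∏∈ S v * ∏∈ T v                    ≡⟨ ∏-distrib-* (factor s) (factor t) ⟨
  ∏ (λ i → factor s i * factor t i)  ≡⟨ ∏-cong (λ i → when-∨-∧ (s i) (t i)) ⟩
  ∏ (λ i → factor (λ j → s j ∨ t j) i * factor (λ j → s j ∧ t j) i)
    ≡⟨ ∏-distrib-* (factor (λ j → s j ∨ t j)) (factor (λ j → s j ∧ t j)) ⟩
  ∏ (factor (λ j → s j ∨ t j)) * ∏ (factor (λ j → s j ∧ t j))
    ≡⟨ cong₂ _*_ (∏-cong λ i → cong (λ b → when b (v i)) (lookup-∪ S T i))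
                 (∏-cong λ i → cong (λ b → when b (v i)) (lookup-∩ S T i)) ⟨
  ∏∈ (S ∪ T) v * ∏∈ (S ∩ T) v        ∎
  where
  s t : Fin k → Bool
  s = lookup S
  t = lookup T
  factor : (Fin k → Bool) → Fin k → ℕ
  factor u i = when (u i) (v i)
  when-∨-∧ : ∀ a b {d} → when a d * when b d ≡ when (a ∨ b) d * when (a ∧ b) d
  when-∨-∧ true  true  = refl
  when-∨-∧ true  false = refl
  when-∨-∧ false true  = *-comm 1 _
  when-∨-∧ false false = refl

∏∈-reflect : ∀ (S : Subset k) v → ∏∈ (reflect S) v ≡ ∏∈ S (v ∘ opposite)
∏∈-reflect S v = begin
  ∏ (λ i → when (lookup (reflect S) i) (v i))
    ≡⟨ ∏-cong (λ i → cong₂ when (lookup-reflect S i) (cong v (sym (opposite-involutive i)))) ⟩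
  ∏ (λ i → when (lookup S (opposite i)) (v (opposite (opposite i))))
    ≡⟨ ∏-reverse (λ i → when (lookup S i) (v (opposite i))) ⟩
  ∏∈ S (v ∘ opposite) ∎

∏∈-square : ∀ (S : Subset k) {v} → v ∘ opposite ≗ v →
  ∏∈ S v * ∏∈ S v ≡ ∏∈ (S ∪ reflect S) v * ∏∈ (S ∩ reflect S) v
∏∈-square S {v} v-symmetric = begin
  ∏∈ S v * ∏∈ S v             ≡⟨ cong (∏∈ S v *_) (∏∈-cong S v-symmetric) ⟨
  ∏∈ S v * ∏∈ S (v ∘ opposite) ≡⟨ cong (∏∈ S v *_) (∏∈-reflect S v) ⟨
  ∏∈ S v * ∏∈ (reflect S) v    ≡⟨ ∏∈-∪-∩ S (reflect S) v ⟩
  ∏∈ (S ∪ reflect S) v * ∏∈ (S ∩ reflect S) v ∎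

∏∈-shuffle : ∀ {S S' : Subset k} {v} → v ∘ opposite ≗ v →
  S ∪ reflect S ≡ S' ∪ reflect S' → S ∩ reflect S ≡ S' ∩ reflect S' → ∏∈ S v ≡ ∏∈ S' v
∏∈-shuffle {S = S} {S'} {v} v-symmetric ∪-eq ∩-eq = *-self-injective _ _ (begin
  ∏∈ S v * ∏∈ S v                                ≡⟨ ∏∈-square S v-symmetric ⟩
  ∏∈ (S ∪ reflect S) v * ∏∈ (S ∩ reflect S) v    ≡⟨ cong₂ (λ U I → ∏∈ U v * ∏∈ I v) ∪-eq ∩-eq ⟩
  ∏∈ (S' ∪ reflect S') v * ∏∈ (S' ∩ reflect S') v ≡⟨ ∏∈-square S' v-symmetric ⟨
  ∏∈ S' v * ∏∈ S' v                              ∎)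

distTo : Subset k → Fin k → ℕ
distTo B i = ∏∈ B (λ j → dist (toℕ i) (toℕ j))

distTo-opposite : ∀ (B : Subset k) → reflect B ≡ B → distTo B ∘ opposite ≗ distTo B
distTo-opposite B B-symmetric i = begin
  ∏∈ B (λ j → dist (toℕ (opposite i)) (toℕ j))               ≡⟨ cong (λ S → ∏∈ S _) B-symmetric ⟨
  ∏∈ (reflect B) (λ j → dist (toℕ (opposite i)) (toℕ j))     ≡⟨ ∏∈-reflect B _ ⟩
  ∏∈ B (λ j → dist (toℕ (opposite i)) (toℕ (opposite j)))    ≡⟨ ∏∈-cong B (dist-opposite i) ⟩
  distTo B i                                                 ∎

cross≡∏∈-distTo : ∀ (A B : Subset k) → cross A B ≡ ∏∈ A (distTo B)
cross≡∏∈-distTo A B = begin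
  Δ₂ A B * Δ₂ B A
    ≡⟨ cong (Δ₂ A B *_) (∏-comm (Δ₂-factor B A)) ⟩
  Δ₂ A B * ∏ (λ i → ∏ λ j → Δ₂-factor B A j i)
    ≡⟨ ∏²-distrib-* (Δ₂-factor A B) (λ i j → Δ₂-factor B A j i) ⟨
  ∏ (λ i → ∏ λ j → Δ₂-factor A B i j * Δ₂-factor B A j i)
    ≡⟨ ∏-cong (λ i → trans (∏-cong λ j → when-∧-pair (lookup A i) (lookup B j))
                           (∏-when (lookup A i) (λ j → when (lookup B j) (dist (toℕ i) (toℕ j))))) ⟩
  ∏∈ A (distTo B) ∎
  where
  when-∧-pair : ∀ a b {d e} → when (a ∧ b) d * when (b ∧ a) e ≡ when a (when b (d * e))
  when-∧-pair true  true  = refl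
  when-∧-pair true  false = refl
  when-∧-pair false true  = refl
  when-∧-pair false false = refl

cross-shuffle : ∀ {X X' Z : Subset k} → reflect Z ≡ Z →
  X ∪ reflect X ≡ X' ∪ reflect X' → X ∩ reflect X ≡ X' ∩ reflect X' → cross X Z ≡ cross X' Z
cross-shuffle {X = X} {X'} {Z} Z-symmetric ∪-eq ∩-eq = begin
  cross X Z         ≡⟨ cross≡∏∈-distTo X Z ⟩
  ∏∈ X (distTo Z)   ≡⟨ ∏∈-shuffle (distTo-opposite Z Z-symmetric) ∪-eq ∩-eq ⟩
  ∏∈ X' (distTo Z)  ≡⟨ cross≡∏∈-distTo X' Z ⟨
  cross X' Z        ∎

lemma5p2 : (k : ℕ) → 1 ≤ k → (X X' Z : Subset k)
    → X ∪ reflect X ≡ X' ∪ reflect X'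
    → X ∩ reflect X ≡ X' ∩ reflect X'
    → Z ∩ (X ∪ reflect X) ≡ ⊥
    → Z ≡ reflect Z
    → Δ₁ (X' ∪ Z) * Δ₁ X ≡ Δ₁ (X ∪ Z) * Δ₁ X'
lemma5p2 k _ X X' Z ∪-eq ∩-eq Z-disjoint Z-symmetric = begin
  Δ₁ (X' ∪ Z) * Δ₁ X                  ≡⟨ cong (_* Δ₁ X) (Δ₁-∪ X' Z X'∩Z≡⊥) ⟩
  (Δ₁ X' * Δ₁ Z) * cross X' Z * Δ₁ X  ≡⟨ cong (λ c → (Δ₁ X' * Δ₁ Z) * c * Δ₁ X)
                                           (cross-shuffle (sym Z-symmetric) ∪-eq ∩-eq) ⟨
  (Δ₁ X' * Δ₁ Z) * cross X Z * Δ₁ X   ≡⟨ solve 4 (λ a a' z c → (a' :* z) :* c :* a := (a :* z) :* c :* a')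
                                           refl (Δ₁ X) (Δ₁ X') (Δ₁ Z) (cross X Z) ⟩
  (Δ₁ X * Δ₁ Z) * cross X Z * Δ₁ X'   ≡⟨ cong (_* Δ₁ X') (Δ₁-∪ X Z X∩Z≡⊥) ⟨
  Δ₁ (X ∪ Z) * Δ₁ X'                  ∎
  where
  X∪X̄∩Z≡⊥ : (X ∪ reflect X) ∩ Z ≡ ⊥
  X∪X̄∩Z≡⊥ = trans (∩-comm _ Z) Z-disjoint
  X∩Z≡⊥ : X ∩ Z ≡ ⊥
  X∩Z≡⊥ = ∩≡⊥-antimonoˡ Z (p⊆p∪q (reflect X)) X∪X̄∩Z≡⊥
  X'∩Z≡⊥ : X' ∩ Z ≡ ⊥
  X'∩Z≡⊥ = ∩≡⊥-antimonoˡ Z (subst (X' ⊆_) (sym ∪-eq) (p⊆p∪q (reflect X'))) X∪X̄∩Z≡⊥
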